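{- Let $k\ge 1$. The number of unordered positions $\{a,b,a+b\}$, where $\{a,b\}$ is an unordered pair of positive integers with $a\oplus b\oplus(a+b)=0$, in which all three piles have at most $k$ binary digits, equals $\frac{3^k}{2}-2^k+\frac12$.
   Context: $\oplus$ denotes bitwise exclusive-or. -}

module Defs where

open import Data.Nat using (ℕ; zero; suc; _+_; _*_; _^_; _≤_; _<_; _≤?_; _<?_; _≟_)
open import Data.Nat.DivMod using (_/_; _%_)
open import Data.Bool using (Bool; true; false; _xor_)
open import Data.List using (List; []; _∷_; length; filter; concatMap; upTo; map)
open import Data.Product using (_×_; _,_; proj₁; proj₂)
open import Relation.Binary.PropositionalEquality using (_≡_)
open import Relation.Nullary using (Dec)
open import Relation.Nullary.Decidable using (_×-dec_)

bit0 : ℕ → Bool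
bit0 n with n % 2
... | zero = false
... | suc _ = true

fromBool : Bool → ℕ
fromBool false = 0
fromBool true  = 1

xorFuel : ℕ → ℕ → ℕ → ℕ
xorFuel zero    a b = 0
xorFuel (suc f) a b = fromBool (bit0 a xor bit0 b) + 2 * xorFuel f (a / 2) (b / 2)

-- a ⊕ b (fuel a + b + 1 exceeds the number of binary digits of a and b)
infixl 6 _⊕_
_⊕_ : ℕ → ℕ → ℕ
a ⊕ b = xorFuel (suc (a + b)) a b

AtMostDigits : ℕ → ℕ → Set
AtMostDigits k n = n < 2 ^ k

Good : ℕ → ℕ × ℕ → Set
Good k (a , b) = (a ⊕ b ⊕ (a + b) ≡ 0)
               × (AtMostDigits k a × (AtMostDigits k b × AtMostDigits k (a + b)))

good? : ∀ k p → Dec (Good k p)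
good? k (a , b) = ((a ⊕ b ⊕ (a + b)) ≟ 0)
                  ×-dec ((a <? 2 ^ k) ×-dec ((b <? 2 ^ k) ×-dec ((a + b) <? 2 ^ k)))

-- candidate unordered pairs {a,b} of positive integers, represented as (a , b)
-- with 1 ≤ a ≤ b, and both below the bound N
candidates : ℕ → List (ℕ × ℕ)
candidates N = concatMap (λ b → map (λ a → (suc a , suc b)) (upTo (suc b))) (upTo N)

countPositions : ℕ → ℕ
countPositions k = length (filter (good? k) (candidates (2 ^ k)))

module Submission where

-- Write a = r + 2a′ and b = s + 2b′ with binary digits r, s. If r and s are not both 1, then
-- a ⊕ b ⊕ (a + b) = 2 (a′ ⊕ b′ ⊕ (a′ + b′)) and a + b < 2^(k+1) iff a′ + b′ < 2^k; if both are 1,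
-- the carry makes a ⊕ b ⊕ (a + b) nonzero. So the ordered pairs of naturals with
-- a ⊕ b ⊕ (a + b) = 0 and a + b < 2^k are counted by three choices per digit: there are 3^k.
-- Of these, 2·2^k − 1 have a zero entry, none has a = b > 0, and the rest come in pairs
-- (a, b), (b, a); hence 3^k = 2·2^k − 1 + 2·(number of positions).

open import Defs
open import Data.Bool using (Bool; true; false; _xor_; _∧_)
open import Data.Bool.Properties using (xor-same; xor-comm)
open import Data.List using (List; _∷_; _++_; length; filter; concatMap; map; applyUpTo)
open import Data.List.Properties using (filter-++; length-++)
open import Data.Nat
open import Data.Nat.DivMod
open import Data.Nat.Divisibility using (m∣m*n)
open import Data.Nat.Properties
open import Data.Nat.Tactic.RingSolver using (solve-∀)
open import Data.Product using (_×_; _,_; proj₂)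
open import Data.Product.Function.NonDependent.Propositional using (_×-⇔_)
open import Function.Bundles using (_⇔_; mk⇔; Equivalence)
open import Function.Properties.Equivalence using () renaming (trans to ⇔-trans; sym to ⇔-sym)
open import Relation.Binary.PropositionalEquality
open import Relation.Nullary using (¬_; Dec; does)
open import Relation.Nullary.Decidable using (dec-true; dec-false; does-⇔)
open import Relation.Unary using (Pred; Decidable)

open ≡-Reasoning
open Equivalence using (to; from)

infixr 5 _∷ᵇ_

_∷ᵇ_ : Bool → ℕ → ℕ
r ∷ᵇ a = fromBool r + 2 * a

fromBool-injective : ∀ {r s} → fromBool r ≡ fromBool s → r ≡ s
fromBool-injective {false} {false} _ = refl
fromBool-injective {true}  {true}  _ = refl

fromBool<2 : ∀ r → fromBool r < 2
fromBool<2 false = s≤s z≤n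
fromBool<2 true  = s≤s (s≤s z≤n)

fromBool-bit0 : ∀ n → fromBool (bit0 n) ≡ n % 2
fromBool-bit0 n with n % 2 | m%n<n n 2
... | 0 | _ = refl
... | 1 | _ = refl
... | suc (suc _) | s≤s (s≤s ())

bit0∷ᵇhalf : ∀ n → bit0 n ∷ᵇ (n / 2) ≡ n
bit0∷ᵇhalf n = begin
  fromBool (bit0 n) + 2 * (n / 2) ≡⟨ cong₂ _+_ (fromBool-bit0 n) (*-comm 2 (n / 2)) ⟩
  n % 2 + n / 2 * 2               ≡⟨ sym (m≡m%n+[m/n]*n n 2) ⟩
  n                               ∎

bit0-∷ᵇ : ∀ r a → bit0 (r ∷ᵇ a) ≡ r
bit0-∷ᵇ r a = fromBool-injective (begin
  fromBool (bit0 (r ∷ᵇ a)) ≡⟨ fromBool-bit0 (r ∷ᵇ a) ⟩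
  (r ∷ᵇ a) % 2             ≡⟨ %-remove-+ʳ (fromBool r) (m∣m*n a) ⟩
  fromBool r % 2           ≡⟨ m<n⇒m%n≡m (fromBool<2 r) ⟩
  fromBool r               ∎)

∷ᵇ-half : ∀ r a → (r ∷ᵇ a) / 2 ≡ a
∷ᵇ-half r a = begin
  (r ∷ᵇ a) / 2               ≡⟨ +-distrib-/-∣ʳ (fromBool r) (m∣m*n a) ⟩
  fromBool r / 2 + 2 * a / 2 ≡⟨ cong₂ _+_ (m<n⇒m/n≡0 (fromBool<2 r)) (cong (_/ 2) (*-comm 2 a)) ⟩
  a * 2 / 2                  ≡⟨ m*n/n≡m a 2 ⟩
  a                          ∎

≤-∷ᵇ : ∀ r a → a ≤ r ∷ᵇ a
≤-∷ᵇ r a = ≤-trans (m≤m+n a (a + 0)) (m≤n+m (2 * a) (fromBool r))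

∷ᵇ≡0⇒ : ∀ {r a} → r ∷ᵇ a ≡ 0 → r ≡ false × a ≡ 0
∷ᵇ≡0⇒ {false} {zero} _ = refl , refl

halves-≤ : ∀ a b {f} → a + b ≤ suc f → a / 2 + b / 2 ≤ f
halves-≤ zero    zero    _ = z≤n
halves-≤ zero    (suc b) p = s≤s⁻¹ (≤-trans (m/n<m (suc b) 2 (s≤s (s≤s z≤n))) p)
halves-≤ (suc a) b       p = s≤s⁻¹ (≤-trans (+-mono-<-≤ (m/n<m (suc a) 2 (s≤s (s≤s z≤n))) (m/n≤m b 2)) p)

-- Bitwise exclusive or

xorFuel-self : ∀ f x → xorFuel f x x ≡ 0
xorFuel-self zero    x = refl
xorFuel-self (suc f) x rewrite xor-same (bit0 x) | xorFuel-self f (x / 2) = refl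

xorFuel-comm : ∀ f a b → xorFuel f a b ≡ xorFuel f b a
xorFuel-comm zero    a b = refl
xorFuel-comm (suc f) a b rewrite xor-comm (bit0 a) (bit0 b) | xorFuel-comm f (a / 2) (b / 2) = refl

fromBool-xor≤ : ∀ r s → fromBool (r xor s) ≤ fromBool r + fromBool s
fromBool-xor≤ false s     = ≤-refl
fromBool-xor≤ true  false = ≤-refl
fromBool-xor≤ true  true  = z≤n

xorFuel≤+ : ∀ f a b → xorFuel f a b ≤ a + b
xorFuel≤+ zero    a b = z≤n
xorFuel≤+ (suc f) a b =
  ≤-trans (+-mono-≤ (fromBool-xor≤ (bit0 a) (bit0 b)) (*-monoʳ-≤ 2 (xorFuel≤+ f (a / 2) (b / 2))))
          (≤-reflexive (trans (regroup (fromBool (bit0 a)) (fromBool (bit0 b)) (a / 2) (b / 2))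
                              (cong₂ _+_ (bit0∷ᵇhalf a) (bit0∷ᵇhalf b))))
  where
  regroup : ∀ x y u v → x + y + 2 * (u + v) ≡ (x + 2 * u) + (y + 2 * v)
  regroup = solve-∀

xorFuel-irrelevant : ∀ {f g} a b → a + b ≤ f → a + b ≤ g → xorFuel f a b ≡ xorFuel g a b
xorFuel-irrelevant {zero}  {g}     0 0 _ _ = sym (xorFuel-self g 0)
xorFuel-irrelevant {suc f} {zero}  0 0 _ _ = xorFuel-self (suc f) 0
xorFuel-irrelevant {suc f} {suc g} a b p q =
  cong ((bit0 a xor bit0 b) ∷ᵇ_) (xorFuel-irrelevant (a / 2) (b / 2) (halves-≤ a b p) (halves-≤ a b q))

xorFuel-identityˡ : ∀ {f} b → b ≤ f → xorFuel f 0 b ≡ b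
xorFuel-identityˡ {zero}  0 _ = refl
xorFuel-identityˡ {suc f} b p =
  trans (cong (bit0 b ∷ᵇ_) (xorFuel-identityˡ (b / 2) (halves-≤ 0 b p))) (bit0∷ᵇhalf b)

xor≡false⇒≡ : ∀ r s → r xor s ≡ false → r ≡ s
xor≡false⇒≡ false false _ = refl
xor≡false⇒≡ true  true  _ = refl

xorFuel≡0⇒≡ : ∀ {f} a b → a + b ≤ f → xorFuel f a b ≡ 0 → a ≡ b
xorFuel≡0⇒≡ {zero}  0 0 _ _ = refl
xorFuel≡0⇒≡ {suc f} a b p e with ∷ᵇ≡0⇒ {bit0 a xor bit0 b} e
... | bits-agree , halves-agree = begin
  a                      ≡⟨ sym (bit0∷ᵇhalf a) ⟩
  bit0 a ∷ᵇ (a / 2)      ≡⟨ cong₂ _∷ᵇ_ (xor≡false⇒≡ (bit0 a) (bit0 b) bits-agree)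
                                       (xorFuel≡0⇒≡ (a / 2) (b / 2) (halves-≤ a b p) halves-agree) ⟩
  bit0 b ∷ᵇ (b / 2)      ≡⟨ bit0∷ᵇhalf b ⟩
  b                      ∎

⊕-self : ∀ x → x ⊕ x ≡ 0
⊕-self x = xorFuel-self (suc (x + x)) x

⊕-comm : ∀ a b → a ⊕ b ≡ b ⊕ a
⊕-comm a b = trans (xorFuel-comm (suc (a + b)) a b) (cong (λ f → xorFuel (suc f) b a) (+-comm a b))

⊕-identityˡ : ∀ b → 0 ⊕ b ≡ b
⊕-identityˡ b = xorFuel-identityˡ b (n≤1+n b)

⊕≤+ : ∀ a b → a ⊕ b ≤ a + b
⊕≤+ a b = xorFuel≤+ (suc (a + b)) a b

⊕≡0⇒≡ : ∀ a b → a ⊕ b ≡ 0 → a ≡ b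
⊕≡0⇒≡ a b = xorFuel≡0⇒≡ a b (n≤1+n (a + b))

⊕-∷ᵇ : ∀ r s a b → (r ∷ᵇ a) ⊕ (s ∷ᵇ b) ≡ (r xor s) ∷ᵇ (a ⊕ b)
⊕-∷ᵇ r s a b = cong₂ _∷ᵇ_ (cong₂ _xor_ (bit0-∷ᵇ r a) (bit0-∷ᵇ s b)) (begin
  xorFuel (x + y) (x / 2) (y / 2) ≡⟨ cong₂ (xorFuel (x + y)) (∷ᵇ-half r a) (∷ᵇ-half s b) ⟩
  xorFuel (x + y) a b             ≡⟨ xorFuel-irrelevant a b (+-mono-≤ (≤-∷ᵇ r a) (≤-∷ᵇ s b)) (n≤1+n (a + b)) ⟩
  a ⊕ b                           ∎)
  where
  x = r ∷ᵇ a
  y = s ∷ᵇ b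

ZeroNimSum : ℕ → ℕ → Set
ZeroNimSum a b = a ⊕ b ⊕ (a + b) ≡ 0

ZeroNimSum-sym : ∀ a b → ZeroNimSum a b → ZeroNimSum b a
ZeroNimSum-sym a b = trans (cong₂ _⊕_ (⊕-comm b a) (+-comm b a))

ZeroNimSum-zeroˡ : ∀ b → ZeroNimSum 0 b
ZeroNimSum-zeroˡ b = trans (cong (_⊕ b) (⊕-identityˡ b)) (⊕-self b)

¬ZeroNimSum-diagonal : ∀ a → ¬ ZeroNimSum (suc a) (suc a)
¬ZeroNimSum-diagonal a z = 1+n≢0 (begin
  x + x           ≡⟨ sym (⊕-identityˡ (x + x)) ⟩
  0 ⊕ (x + x)     ≡⟨ cong (_⊕ (x + x)) (sym (⊕-self x)) ⟩
  x ⊕ x ⊕ (x + x) ≡⟨ z ⟩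
  0               ∎)
  where
  x = suc a

fromBool-xor : ∀ r s → r ∧ s ≡ false → fromBool r + fromBool s ≡ fromBool (r xor s)
fromBool-xor false s     _ = refl
fromBool-xor true  false _ = refl

+-∷ᵇ : ∀ r s a b → r ∧ s ≡ false → (r ∷ᵇ a) + (s ∷ᵇ b) ≡ (r xor s) ∷ᵇ (a + b)
+-∷ᵇ r s a b r∧s≡false =
  trans (regroup (fromBool r) (fromBool s) a b) (cong (_+ 2 * (a + b)) (fromBool-xor r s r∧s≡false))
  where
  regroup : ∀ x y u v → (x + 2 * u) + (y + 2 * v) ≡ (x + y) + 2 * (u + v)
  regroup = solve-∀

nimSum-∷ᵇ : ∀ r s a b → r ∧ s ≡ false →
  (r ∷ᵇ a) ⊕ (s ∷ᵇ b) ⊕ ((r ∷ᵇ a) + (s ∷ᵇ b)) ≡ false ∷ᵇ (a ⊕ b ⊕ (a + b))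
nimSum-∷ᵇ r s a b r∧s≡false = begin
  (r ∷ᵇ a) ⊕ (s ∷ᵇ b) ⊕ ((r ∷ᵇ a) + (s ∷ᵇ b))
    ≡⟨ cong₂ _⊕_ (⊕-∷ᵇ r s a b) (+-∷ᵇ r s a b r∧s≡false) ⟩
  ((r xor s) ∷ᵇ (a ⊕ b)) ⊕ ((r xor s) ∷ᵇ (a + b))
    ≡⟨ ⊕-∷ᵇ (r xor s) (r xor s) (a ⊕ b) (a + b) ⟩
  ((r xor s) xor (r xor s)) ∷ᵇ (a ⊕ b ⊕ (a + b))
    ≡⟨ cong (_∷ᵇ (a ⊕ b ⊕ (a + b))) (xor-same (r xor s)) ⟩
  false ∷ᵇ (a ⊕ b ⊕ (a + b))
    ∎

ZeroNimSum-∷ᵇ : ∀ r s a b → r ∧ s ≡ false → ZeroNimSum (r ∷ᵇ a) (s ∷ᵇ b) ⇔ ZeroNimSum a b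
ZeroNimSum-∷ᵇ r s a b r∧s≡false = mk⇔
  (λ z → m+n≡0⇒m≡0 _ (trans (sym (nimSum-∷ᵇ r s a b r∧s≡false)) z))
  (λ z → trans (nimSum-∷ᵇ r s a b r∧s≡false) (cong (false ∷ᵇ_) z))

-- The carry out of the lowest digit would force a ⊕ b = a + b + 1, beyond the bound a ⊕ b ≤ a + b.
¬ZeroNimSum-odd : ∀ a b → ¬ ZeroNimSum (true ∷ᵇ a) (true ∷ᵇ b)
¬ZeroNimSum-odd a b z = <-irrefl refl (subst (_≤ a + b) a⊕b≡1+a+b (⊕≤+ a b))
  where
  carry : ∀ a b → (1 + 2 * a) + (1 + 2 * b) ≡ 0 + 2 * suc (a + b)
  carry = solve-∀
  nimSum≡ : (true ∷ᵇ a) ⊕ (true ∷ᵇ b) ⊕ ((true ∷ᵇ a) + (true ∷ᵇ b)) ≡ false ∷ᵇ (a ⊕ b ⊕ suc (a + b))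
  nimSum≡ = trans (cong₂ _⊕_ (⊕-∷ᵇ true true a b) (carry a b)) (⊕-∷ᵇ false false (a ⊕ b) (suc (a + b)))
  a⊕b≡1+a+b : a ⊕ b ≡ suc (a + b)
  a⊕b≡1+a+b = ⊕≡0⇒≡ (a ⊕ b) (suc (a + b)) (m+n≡0⇒m≡0 _ (trans (sym nimSum≡) z))

∷ᵇ<2*⇔ : ∀ r m n → r ∷ᵇ m < 2 * n ⇔ m < n
∷ᵇ<2*⇔ r m n = mk⇔
  (λ lt → *-cancelˡ-< 2 m n (≤-<-trans (m≤n+m (2 * m) (fromBool r)) lt))
  (λ lt → ≤-trans (s≤s (+-monoˡ-≤ (2 * m) (s≤s⁻¹ (fromBool<2 r))))
                  (≤-trans (≤-reflexive (sym (*-suc 2 m))) (*-monoʳ-≤ 2 lt)))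

+-∷ᵇ<2*⇔ : ∀ r s a b n → r ∧ s ≡ false → (r ∷ᵇ a) + (s ∷ᵇ b) < 2 * n ⇔ a + b < n
+-∷ᵇ<2*⇔ r s a b n r∧s≡false =
  subst (λ x → x < 2 * n ⇔ a + b < n) (sym (+-∷ᵇ r s a b r∧s≡false)) (∷ᵇ<2*⇔ (r xor s) (a + b) n)

Good⇔ : ∀ k a b → Good k (a , b) ⇔ (ZeroNimSum a b × a + b < 2 ^ k)
Good⇔ k a b = mk⇔
  (λ (z , _ , _ , lt) → z , lt)
  (λ (z , lt) → z , ≤-<-trans (m≤m+n a b) lt , ≤-<-trans (m≤n+m b a) lt , lt)

𝟙 : ∀ {p} {P : Set p} → Dec P → ℕ
𝟙 P? = fromBool (does P?)

𝟙-⇔ : ∀ {p q} {P : Set p} {Q : Set q} → P ⇔ Q → (P? : Dec P) (Q? : Dec Q) → 𝟙 P? ≡ 𝟙 Q?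
𝟙-⇔ P⇔Q P? Q? = cong fromBool (does-⇔ P⇔Q P? Q?)

𝟙-yes : ∀ {p} {P : Set p} (P? : Dec P) → P → 𝟙 P? ≡ 1
𝟙-yes P? x = cong fromBool (dec-true P? x)

𝟙-no : ∀ {p} {P : Set p} (P? : Dec P) → ¬ P → 𝟙 P? ≡ 0
𝟙-no P? ¬x = cong fromBool (dec-false P? ¬x)

χ : ℕ → ℕ → ℕ → ℕ
χ k a b = 𝟙 (good? k (a , b))

χ-cong : ∀ k a b l c d → (ZeroNimSum a b × a + b < 2 ^ k) ⇔ (ZeroNimSum c d × c + d < 2 ^ l) →
  χ k a b ≡ χ l c d
χ-cong k a b l c d e = 𝟙-⇔ (⇔-trans (Good⇔ k a b) (⇔-trans e (⇔-sym (Good⇔ l c d))))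
  (good? k (a , b)) (good? l (c , d))

χ-vanish : ∀ k a b → ¬ (ZeroNimSum a b × a + b < 2 ^ k) → χ k a b ≡ 0
χ-vanish k a b ¬good = 𝟙-no (good? k (a , b)) (λ g → ¬good (Good⇔ k a b .to g))

χ-sym : ∀ k a b → χ k a b ≡ χ k b a
χ-sym k a b = χ-cong k a b k b a (mk⇔ (swap a b) (swap b a))
  where
  swap : ∀ a b → ZeroNimSum a b × a + b < 2 ^ k → ZeroNimSum b a × b + a < 2 ^ k
  swap a b (z , lt) = ZeroNimSum-sym a b z , subst (_< 2 ^ k) (+-comm a b) lt

χ-diagonal : ∀ k a → χ k (suc a) (suc a) ≡ 0
χ-diagonal k a = χ-vanish k (suc a) (suc a) (λ (z , _) → ¬ZeroNimSum-diagonal a z)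

χ-zeroˡ : ∀ k b → χ k 0 b ≡ 𝟙 (b <? 2 ^ k)
χ-zeroˡ k b = 𝟙-⇔ (mk⇔ (λ g → Good⇔ k 0 b .to g .proj₂)
                        (λ lt → Good⇔ k 0 b .from (ZeroNimSum-zeroˡ b , lt)))
                  (good? k (0 , b)) (b <? 2 ^ k)

χ-outside : ∀ k b → χ k (2 ^ k) b ≡ 0
χ-outside k b = χ-vanish k (2 ^ k) b (λ (_ , lt) → m+n≮m (2 ^ k) b lt)

χ-∷ᵇ : ∀ k r s a b → r ∧ s ≡ false → χ (suc k) (r ∷ᵇ a) (s ∷ᵇ b) ≡ χ k a b
χ-∷ᵇ k r s a b r∧s≡false =
  χ-cong (suc k) (r ∷ᵇ a) (s ∷ᵇ b) k a b
         (ZeroNimSum-∷ᵇ r s a b r∧s≡false ×-⇔ +-∷ᵇ<2*⇔ r s a b (2 ^ k) r∧s≡false)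

χ-odd : ∀ k a b → χ (suc k) (true ∷ᵇ a) (true ∷ᵇ b) ≡ 0
χ-odd k a b = χ-vanish (suc k) (true ∷ᵇ a) (true ∷ᵇ b) (λ (z , _) → ¬ZeroNimSum-odd a b z)

-- Finite sums

∑ : ℕ → (ℕ → ℕ) → ℕ
∑ zero    f = 0
∑ (suc n) f = f 0 + ∑ n (λ i → f (suc i))

∑-cong : ∀ n {f g} → (∀ i → f i ≡ g i) → ∑ n f ≡ ∑ n g
∑-cong zero    f≗g = refl
∑-cong (suc n) f≗g = cong₂ _+_ (f≗g 0) (∑-cong n (λ i → f≗g (suc i)))

∑-snoc : ∀ n f → ∑ (suc n) f ≡ ∑ n f + f n
∑-snoc zero    f = +-identityʳ (f 0)
∑-snoc (suc n) f = trans (cong (f 0 +_) (∑-snoc n (λ i → f (suc i)))) (sym (+-assoc (f 0) _ _))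

∑-zero : ∀ n → ∑ n (λ _ → 0) ≡ 0
∑-zero zero    = refl
∑-zero (suc n) = ∑-zero n

∑-+ : ∀ n f g → ∑ n (λ i → f i + g i) ≡ ∑ n f + ∑ n g
∑-+ zero    f g = refl
∑-+ (suc n) f g = begin
  f 0 + g 0 + ∑ n (λ i → f (suc i) + g (suc i))
    ≡⟨ cong (f 0 + g 0 +_) (∑-+ n (λ i → f (suc i)) (λ i → g (suc i))) ⟩
  f 0 + g 0 + (∑ n (λ i → f (suc i)) + ∑ n (λ i → g (suc i)))
    ≡⟨ +-comm-middle (f 0) (g 0) _ _ ⟩
  f 0 + ∑ n (λ i → f (suc i)) + (g 0 + ∑ n (λ i → g (suc i)))
    ∎
  where
  +-comm-middle : ∀ a b c d → a + b + (c + d) ≡ a + c + (b + d)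
  +-comm-middle = solve-∀

∑-even-odd : ∀ n f → ∑ (2 * n) f ≡ ∑ n (λ i → f (2 * i)) + ∑ n (λ i → f (1 + 2 * i))
∑-even-odd zero    f = refl
∑-even-odd (suc n) f = begin
  ∑ (2 * suc n) f
    ≡⟨ cong (λ m → ∑ m f) (*-suc 2 n) ⟩
  ∑ (suc (suc (2 * n))) f
    ≡⟨ trans (∑-snoc (suc (2 * n)) f) (cong (_+ f (1 + 2 * n)) (∑-snoc (2 * n) f)) ⟩
  ∑ (2 * n) f + f (2 * n) + f (1 + 2 * n)
    ≡⟨ cong (λ s → s + f (2 * n) + f (1 + 2 * n)) (∑-even-odd n f) ⟩
  E + O + f (2 * n) + f (1 + 2 * n)
    ≡⟨ regroup E O (f (2 * n)) (f (1 + 2 * n)) ⟩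
  (E + f (2 * n)) + (O + f (1 + 2 * n))
    ≡⟨ cong₂ _+_ (sym (∑-snoc n (λ i → f (2 * i)))) (sym (∑-snoc n (λ i → f (1 + 2 * i)))) ⟩
  ∑ (suc n) (λ i → f (2 * i)) + ∑ (suc n) (λ i → f (1 + 2 * i))
    ∎
  where
  E = ∑ n (λ i → f (2 * i))
  O = ∑ n (λ i → f (1 + 2 * i))
  regroup : ∀ a b c d → a + b + c + d ≡ (a + c) + (b + d)
  regroup = solve-∀

∑-𝟙-< : ∀ {n m} → n ≤ m → ∑ n (λ i → 𝟙 (i <? m)) ≡ n
∑-𝟙-< {zero}  _   = refl
∑-𝟙-< {suc n} {m} n<m = begin
  ∑ (suc n) (λ i → 𝟙 (i <? m))       ≡⟨ ∑-snoc n (λ i → 𝟙 (i <? m)) ⟩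
  ∑ n (λ i → 𝟙 (i <? m)) + 𝟙 (n <? m) ≡⟨ cong₂ _+_ (∑-𝟙-< (<⇒≤ n<m)) (𝟙-yes (n <? m) n<m) ⟩
  n + 1                               ≡⟨ +-comm n 1 ⟩
  suc n                               ∎

∑² : ℕ → (ℕ → ℕ → ℕ) → ℕ
∑² n g = ∑ n (λ b → ∑ n (λ a → g a b))

∑²-cong : ∀ n {g h} → (∀ a b → g a b ≡ h a b) → ∑² n g ≡ ∑² n h
∑²-cong n g≗h = ∑-cong n (λ b → ∑-cong n (λ a → g≗h a b))

∑²-zero : ∀ n → ∑² n (λ _ _ → 0) ≡ 0
∑²-zero n = trans (∑-cong n (λ _ → ∑-zero n)) (∑-zero n)

∑²-snoc : ∀ n g → ∑² (suc n) g ≡ ∑² n g + ∑ n (λ b → g n b) + ∑ (suc n) (λ a → g a n)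
∑²-snoc n g = begin
  ∑ (suc n) (λ b → ∑ (suc n) (λ a → g a b))
    ≡⟨ ∑-snoc n (λ b → ∑ (suc n) (λ a → g a b)) ⟩
  ∑ n (λ b → ∑ (suc n) (λ a → g a b)) + ∑ (suc n) (λ a → g a n)
    ≡⟨ cong (_+ ∑ (suc n) (λ a → g a n))
            (trans (∑-cong n (λ b → ∑-snoc n (λ a → g a b))) (∑-+ n (λ b → ∑ n (λ a → g a b)) (g n))) ⟩
  ∑² n g + ∑ n (λ b → g n b) + ∑ (suc n) (λ a → g a n)
    ∎

∑²-peel : ∀ n g → ∑² (suc n) g ≡
  ∑ (suc n) (λ a → g a 0) + ∑ n (λ b → g 0 (suc b)) + ∑² n (λ a b → g (suc a) (suc b))
∑²-peel n g = begin
  R + ∑ n (λ b → g 0 (suc b) + ∑ n (λ a → g (suc a) (suc b))) ≡⟨ cong (R +_) (∑-+ n (λ b → g 0 (suc b)) _) ⟩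
  R + (C + I)                                                ≡⟨ sym (+-assoc R C I) ⟩
  R + C + I                                                  ∎
  where
  R = ∑ (suc n) (λ a → g a 0)
  C = ∑ n (λ b → g 0 (suc b))
  I = ∑² n (λ a b → g (suc a) (suc b))

∑²-even-odd : ∀ n g → ∑² (2 * n) g ≡
  (∑² n (λ a b → g (2 * a) (2 * b))     + ∑² n (λ a b → g (1 + 2 * a) (2 * b))) +
  (∑² n (λ a b → g (2 * a) (1 + 2 * b)) + ∑² n (λ a b → g (1 + 2 * a) (1 + 2 * b)))
∑²-even-odd n g = begin
  ∑ (2 * n) (λ b → ∑ (2 * n) (λ a → g a b))
    ≡⟨ ∑-cong (2 * n) (λ b → ∑-even-odd n (λ a → g a b)) ⟩
  ∑ (2 * n) (λ b → ∑ n (λ a → g (2 * a) b) + ∑ n (λ a → g (1 + 2 * a) b))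
    ≡⟨ ∑-even-odd n _ ⟩
  ∑ n (λ b → ∑ n (λ a → g (2 * a) (2 * b)) + ∑ n (λ a → g (1 + 2 * a) (2 * b))) +
  ∑ n (λ b → ∑ n (λ a → g (2 * a) (1 + 2 * b)) + ∑ n (λ a → g (1 + 2 * a) (1 + 2 * b)))
    ≡⟨ cong₂ _+_ (∑-+ n _ _) (∑-+ n _ _) ⟩
  (∑² n (λ a b → g (2 * a) (2 * b))     + ∑² n (λ a b → g (1 + 2 * a) (2 * b))) +
  (∑² n (λ a b → g (2 * a) (1 + 2 * b)) + ∑² n (λ a b → g (1 + 2 * a) (1 + 2 * b)))
    ∎

∑²-extend : ∀ n g → (∀ b → g n b ≡ 0) → (∀ a → g a n ≡ 0) → ∑² (suc n) g ≡ ∑² n g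
∑²-extend n g row col = begin
  ∑² (suc n) g                                         ≡⟨ ∑²-snoc n g ⟩
  ∑² n g + ∑ n (λ b → g n b) + ∑ (suc n) (λ a → g a n)
    ≡⟨ cong₂ (λ x y → ∑² n g + x + y) (vanish n row) (vanish (suc n) col) ⟩
  ∑² n g + 0 + 0                                       ≡⟨ cong (_+ 0) (+-identityʳ _) ⟩
  ∑² n g + 0                                           ≡⟨ +-identityʳ _ ⟩
  ∑² n g                                               ∎
  where
  vanish : ∀ m {f} → (∀ i → f i ≡ 0) → ∑ m f ≡ 0
  vanish m f≗0 = trans (∑-cong m f≗0) (∑-zero m)

2*∑-triangle≡∑² : ∀ n g → (∀ a b → g a b ≡ g b a) → (∀ a → g a a ≡ 0) →
  2 * ∑ n (λ b → ∑ (suc b) (λ a → g a b)) ≡ ∑² n g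
2*∑-triangle≡∑² zero    g sym-g diag-g = refl
2*∑-triangle≡∑² (suc n) g sym-g diag-g = begin
  2 * ∑ (suc n) (λ b → ∑ (suc b) (λ a → g a b))
    ≡⟨ cong (2 *_) (∑-snoc n (λ b → ∑ (suc b) (λ a → g a b))) ⟩
  2 * (∑ n (λ b → ∑ (suc b) (λ a → g a b)) + C)
    ≡⟨ *-distribˡ-+ 2 (∑ n (λ b → ∑ (suc b) (λ a → g a b))) C ⟩
  2 * ∑ n (λ b → ∑ (suc b) (λ a → g a b)) + 2 * C
    ≡⟨ cong (_+ 2 * C) (2*∑-triangle≡∑² n g sym-g diag-g) ⟩
  ∑² n g + 2 * C
    ≡⟨ split (∑² n g) C ⟩
  ∑² n g + C + C
    ≡⟨ cong (λ x → ∑² n g + x + C) (sym row≡column) ⟩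
  ∑² n g + ∑ n (λ b → g n b) + C
    ≡⟨ sym (∑²-snoc n g) ⟩
  ∑² (suc n) g
    ∎
  where
  C = ∑ (suc n) (λ a → g a n)
  row≡column : ∑ n (λ b → g n b) ≡ C
  row≡column = begin
    ∑ n (λ b → g n b)           ≡⟨ ∑-cong n (λ b → sym-g n b) ⟩
    ∑ n (λ a → g a n)           ≡⟨ sym (+-identityʳ _) ⟩
    ∑ n (λ a → g a n) + 0       ≡⟨ cong (∑ n (λ a → g a n) +_) (sym (diag-g n)) ⟩
    ∑ n (λ a → g a n) + g n n   ≡⟨ sym (∑-snoc n (λ a → g a n)) ⟩
    C                           ∎
  split : ∀ s c → s + 2 * c ≡ s + c + c
  split = solve-∀

module _ {a p} {A : Set a} {P : Pred A p} (P? : Decidable P) where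

  length-filter-∷ : ∀ x xs → length (filter P? (x ∷ xs)) ≡ 𝟙 (P? x) + length (filter P? xs)
  length-filter-∷ x xs with does (P? x)
  ... | true  = refl
  ... | false = refl

  length-filter-map-applyUpTo : ∀ (f : ℕ → A) g n →
    length (filter P? (map f (applyUpTo g n))) ≡ ∑ n (λ i → 𝟙 (P? (f (g i))))
  length-filter-map-applyUpTo f g zero    = refl
  length-filter-map-applyUpTo f g (suc n) =
    trans (length-filter-∷ (f (g 0)) _)
          (cong (𝟙 (P? (f (g 0))) +_) (length-filter-map-applyUpTo f (λ i → g (suc i)) n))

  length-filter-concatMap-applyUpTo : ∀ (F : ℕ → List A) g n →
    length (filter P? (concatMap F (applyUpTo g n))) ≡ ∑ n (λ i → length (filter P? (F (g i))))
  length-filter-concatMap-applyUpTo F g zero    = refl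
  length-filter-concatMap-applyUpTo F g (suc n) = begin
    length (filter P? (F (g 0) ++ rest))
      ≡⟨ cong length (filter-++ P? (F (g 0)) rest) ⟩
    length (filter P? (F (g 0)) ++ filter P? rest)
      ≡⟨ length-++ (filter P? (F (g 0))) ⟩
    length (filter P? (F (g 0))) + length (filter P? rest)
      ≡⟨ cong (length (filter P? (F (g 0))) +_) (length-filter-concatMap-applyUpTo F (λ i → g (suc i)) n) ⟩
    ∑ (suc n) (λ i → length (filter P? (F (g i))))
      ∎
    where
    rest = concatMap F (applyUpTo (λ i → g (suc i)) n)

countPositions≡∑ : ∀ k → countPositions k ≡ ∑ (2 ^ k) (λ b → ∑ (suc b) (λ a → χ k (suc a) (suc b)))
countPositions≡∑ k =
  trans (length-filter-concatMap-applyUpTo (good? k) _ (λ b → b) (2 ^ k))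
        (∑-cong (2 ^ k) λ b →
           length-filter-map-applyUpTo (good? k) (λ a → suc a , suc b) (λ a → a) (suc b))

-- The ordered count

∑²-χ≡3^k : ∀ k → ∑² (2 ^ k) (χ k) ≡ 3 ^ k
∑²-χ≡3^k zero    = refl
∑²-χ≡3^k (suc k) = begin
  ∑² (2 * N) (χ (suc k))
    ≡⟨ ∑²-even-odd N (χ (suc k)) ⟩
  (∑² N (digits false false) + ∑² N (digits true false)) +
  (∑² N (digits false true)  + ∑² N (digits true true))
    ≡⟨ cong₂ _+_ (cong₂ _+_ (halve false false refl) (halve true false refl))
                 (cong₂ _+_ (halve false true refl) (trans (∑²-cong N (χ-odd k)) (∑²-zero N))) ⟩
  (S + S) + (S + 0)
    ≡⟨ triple S ⟩
  3 * S
    ≡⟨ cong (3 *_) (∑²-χ≡3^k k) ⟩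
  3 ^ suc k
    ∎
  where
  N = 2 ^ k
  S = ∑² N (χ k)
  digits : Bool → Bool → ℕ → ℕ → ℕ
  digits r s a b = χ (suc k) (r ∷ᵇ a) (s ∷ᵇ b)
  halve : ∀ r s → r ∧ s ≡ false → ∑² N (digits r s) ≡ S
  halve r s r∧s≡false = ∑²-cong N (λ a b → χ-∷ᵇ k r s a b r∧s≡false)
  triple : ∀ s → (s + s) + (s + 0) ≡ 3 * s
  triple = solve-∀

-- From ordered pairs to unordered positions

∑-χ-zeroˡ : ∀ k → ∑ (suc (2 ^ k)) (λ a → χ k 0 a) ≡ 2 ^ k
∑-χ-zeroˡ k = begin
  ∑ (suc N) (λ a → χ k 0 a)                 ≡⟨ ∑-cong (suc N) (χ-zeroˡ k) ⟩
  ∑ (suc N) (λ a → 𝟙 (a <? N))              ≡⟨ ∑-snoc N (λ a → 𝟙 (a <? N)) ⟩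
  ∑ N (λ a → 𝟙 (a <? N)) + 𝟙 (N <? N)       ≡⟨ cong₂ _+_ (∑-𝟙-< ≤-refl) (𝟙-no (N <? N) (n≮n N)) ⟩
  N + 0                                     ≡⟨ +-identityʳ N ⟩
  N                                         ∎
  where
  N = 2 ^ k

∑²-χ-countPositions : ∀ k → ∑² (2 ^ k) (χ k) + 1 ≡ 2 * countPositions k + 2 * 2 ^ k
∑²-χ-countPositions k = begin
  ∑² N (χ k) + 1
    ≡⟨ cong (_+ 1) (sym (∑²-extend N (χ k) (χ-outside k) (λ a → trans (χ-sym k a N) (χ-outside k a)))) ⟩
  ∑² (suc N) (χ k) + 1
    ≡⟨ cong (_+ 1) (∑²-peel N (χ k)) ⟩
  ∑ (suc N) (λ a → χ k a 0) + A + ∑² N g + 1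
    ≡⟨ cong (λ x → x + A + ∑² N g + 1) (trans (∑-cong (suc N) (λ a → χ-sym k a 0)) (∑-χ-zeroˡ k)) ⟩
  N + A + ∑² N g + 1
    ≡⟨ rearrange (∑² N g) 1+A≡N ⟩
  ∑² N g + 2 * N
    ≡⟨ cong (_+ 2 * N) (sym (trans (cong (2 *_) (countPositions≡∑ k))
                                    (2*∑-triangle≡∑² N g (λ a b → χ-sym k (suc a) (suc b)) (χ-diagonal k)))) ⟩
  2 * countPositions k + 2 * N
    ∎
  where
  N = 2 ^ k
  g = λ a b → χ k (suc a) (suc b)
  A = ∑ N (λ b → χ k 0 (suc b))
  1+A≡N : 1 + A ≡ N
  1+A≡N = begin
    1 + A                      ≡⟨ cong (_+ A) (sym (trans (χ-zeroˡ k 0) (𝟙-yes (0 <? N) (m^n>0 2 k)))) ⟩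
    χ k 0 0 + A                ≡⟨⟩
    ∑ (suc N) (λ b → χ k 0 b)  ≡⟨ ∑-χ-zeroˡ k ⟩
    N                          ∎
  rearrange : ∀ {a n} s → 1 + a ≡ n → n + a + s + 1 ≡ s + 2 * n
  rearrange {a} s refl = identity a s
    where
    identity : ∀ a s → 1 + a + a + s + 1 ≡ s + 2 * (1 + a)
    identity = solve-∀

-- The count formula holds for k = 0 as well.
theorem7p9 : (k : ℕ) → 1 ≤ k →
    2 * countPositions k + 2 * 2 ^ k ≡ 3 ^ k + 1
theorem7p9 k _ = begin
  2 * countPositions k + 2 * 2 ^ k ≡⟨ sym (∑²-χ-countPositions k) ⟩
  ∑² (2 ^ k) (χ k) + 1             ≡⟨ cong (_+ 1) (∑²-χ≡3^k k) ⟩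
  3 ^ k + 1                        ∎
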